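{- Let $\lambda$ be a partition whose $2$-quotient $(\mu,\nu)$ satisfies the shifted condition, let $S\in\mathsf{MSShDT}(\lambda)$ have $n$ dominoes, and suppose there exist $i,j\in[n]$ with $i<j$ such that one of the following holds: (I) $i$ and $j'$ are entries of $S$; (II) $i$ and $j$ are entries of $S$, and $\mathrm{dom}_j(S)$ is strictly lower than $\mathrm{dom}_i(S)$; (III) $i'$ and $j'$ are entries of $S$, and $\mathrm{dom}_i(S)$ is weakly below $\mathrm{dom}_j(S)$. Then there is a descent of $S$ in $[i,j-1]$.
   Context: Young diagrams are in English convention. The $2$-quotient of $\lambda=(\lambda_1,\dots,\lambda_k)$: let $\lambda^\star=(\lambda_i+k-i)_i$; let $w$ be obtained from $\lambda^\star$ by replacing its odd parts, from right to left, by $1,3,5,\dots$ and its even parts, from right to left, by $0,2,4,\dots$; then $\mu$ (resp. $\nu$) is obtained by subtracting, position by position, the even (resp. odd) entries of $w$ from the even (resp. odd) entries of $\lambda^\star$, dividing by $2$, and removing zeros. The shifted condition: $\mu=(\mu_1,\dots,\mu_p)$, $\nu=(\nu_1,\dots,\nu_q)$ satisfy $\mu_p\ge p$ and $\nu_q\ge q$. A domino tiling of $\lambda$ (by $1\times2$ and $2\times1$ dominoes) is shifted if there is no vertical domino $d$ lying on the main diagonal such that all dominoes left of $d$ and adjacent to $d$ are strictly below the main diagonal. A standard shifted domino tableau of shape $\lambda$ is a bijective filling of the dominoes weakly above the main diagonal of a shifted tiling of $\lambda$ with $[m]$ ($m$ = number of such dominoes), strictly increasing left to right along rows and top to bottom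 in columns; $\mathsf{SShDT}(\lambda)$ is their set. $\mathrm{dom}_i(Q)$ is the domino containing $i$. For such $Q$ with $n$ dominoes, $i\in[0,n-1]$ is a descent of $Q$ if $i=0$ and $\mathrm{dom}_1(Q)$ is vertical, or $i>0$ and $\mathrm{dom}_{i+1}(Q)$ is strictly lower than $\mathrm{dom}_i(Q)$ (both cells of $\mathrm{dom}_{i+1}(Q)$ lie in rows strictly below both cells of $\mathrm{dom}_i(Q)$). A marked standard shifted domino tableau is a standard shifted domino tableau in which each entry is either primed or unprimed; $\mathsf{MSShDT}(\lambda)$ is their set; $\mathrm{demark}(S)$ removes all primes, and $\mathrm{dom}_i(S)$ is the domino containing $i$ or $i'$. For $S$ with $n$ dominoes, $i\in[0,n-1]$ is a descent of $S$ if: $i=0$ and ($1'$ is in $S$ or $\mathrm{dom}_1(S)$ is vertical); or $i>0$, $i$ (unprimed) is in $S$, and $i$ is a descent of $\mathrm{demark}(S)$; or $i>0$, $(i+1)'$ is in $S$, and $i$ is not a descent of $\mathrm{demark}(S)$. -}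

module Defs where

open import Data.Bool using (Bool; true; false; if_then_else_)
open import Data.Nat using (ℕ; zero; suc; _+_; _*_; _∸_; _≤_; _<_; _%_; _≡ᵇ_; ⌊_/2⌋)
open import Data.Nat.Properties using (_≟_)
open import Data.Product using (_×_; _,_; ∃; ∃-syntax; Σ-syntax)
open import Data.Product.Properties using (≡-dec)
open import Data.Sum using (_⊎_)
open import Data.Unit using (⊤)
open import Data.List using (List; []; _∷_; length; filter; zip)
open import Data.List.Membership.Propositional using (_∈_)
open import Data.List.Membership.DecPropositional (≡-dec _≟_ _≟_) using (_∈?_)
open import Relation.Binary.PropositionalEquality using (_≡_; _≢_)
open import Relation.Nullary using (¬_)

Decreasing : List ℕ → Set
Decreasing []           = ⊤
Decreasing (x ∷ [])     = ⊤
Decreasing (x ∷ y ∷ xs) = (y ≤ x) × Decreasing (y ∷ xs)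

AllPositive : List ℕ → Set
AllPositive []       = ⊤
AllPositive (x ∷ xs) = (1 ≤ x) × AllPositive xs

IsPartition : List ℕ → Set
IsPartition λ' = Decreasing λ' × AllPositive λ'

-- part λ r = λ_{r+1} (0-indexed rows), 0 beyond the length
part : List ℕ → ℕ → ℕ
part []       _       = 0
part (x ∷ xs) zero    = x
part (x ∷ xs) (suc r) = part xs r

isEven : ℕ → Bool
isEven n = (n % 2) ≡ᵇ 0

-- λ⋆ = (λ_i + k - i)_i  (k - i = number of parts after position i)
star : List ℕ → List ℕ
star []       = []
star (x ∷ xs) = (x + length xs) ∷ star xs

countEven : List ℕ → ℕ
countEven []       = 0
countEven (x ∷ xs) = if isEven x then suc (countEven xs) else countEven xs

countOdd : List ℕ → ℕ
countOdd []       = 0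
countOdd (x ∷ xs) = if isEven x then countOdd xs else suc (countOdd xs)

-- w: odd parts replaced right-to-left by 1,3,5,..., even parts by 0,2,4,...
wSeq : List ℕ → List ℕ
wSeq []       = []
wSeq (x ∷ xs) =
  (if isEven x then 2 * countEven xs else suc (2 * countOdd xs)) ∷ wSeq xs

removeZeros : List ℕ → List ℕ
removeZeros []            = []
removeZeros (zero ∷ xs)   = removeZeros xs
removeZeros (suc x ∷ xs)  = suc x ∷ removeZeros xs

halfDiffs : Bool → List (ℕ × ℕ) → List ℕ
halfDiffs p []             = []
halfDiffs p ((a , b) ∷ ps) =
  if (isEven a ≡ᵇool p) then ⌊ (a ∸ b) /2⌋ ∷ halfDiffs p ps else halfDiffs p ps
  where
  _≡ᵇool_ : Bool → Bool → Bool
  true  ≡ᵇool true  = true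
  false ≡ᵇool false = true
  _     ≡ᵇool _     = false

quotientμ : List ℕ → List ℕ
quotientμ λ' = removeZeros (halfDiffs true (zip (star λ') (wSeq (star λ'))))

quotientν : List ℕ → List ℕ
quotientν λ' = removeZeros (halfDiffs false (zip (star λ') (wSeq (star λ'))))

lastPart : ℕ → List ℕ → ℕ
lastPart d []       = d
lastPart d (x ∷ xs) = lastPart x xs

ShiftedList : List ℕ → Set
ShiftedList []       = ⊤
ShiftedList (x ∷ xs) = length (x ∷ xs) ≤ lastPart x xs

ShiftedCondition : List ℕ → Set
ShiftedCondition λ' = ShiftedList (quotientμ λ') × ShiftedList (quotientν λ')

-- Dominoes; cells are (row , column), 0-indexed, English convention

Cell : Set
Cell = ℕ × ℕ

record Domino : Set where
  constructor dom
  field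
    row  : ℕ      -- row of the top-left cell
    col  : ℕ      -- column of the top-left cell
    vert : Bool   -- true: vertical (2×1), false: horizontal (1×2)
open Domino public

cells : Domino → List Cell
cells (dom r c true)  = (r , c) ∷ (suc r , c) ∷ []
cells (dom r c false) = (r , c) ∷ (r , suc c) ∷ []

topRow : Domino → ℕ
topRow d = row d

botRow : Domino → ℕ
botRow d = if vert d then suc (row d) else row d

InShape : List ℕ → Cell → Set
InShape λ' (r , c) = c < part λ' r

IsTiling : List ℕ → List Domino → Set
IsTiling λ' T =
  (∀ d → d ∈ T → ∀ x → x ∈ cells d → InShape λ' x) ×
  (∀ x → InShape λ' x → length (filter (λ d → x ∈? cells d) T) ≡ 1)

StrictlyBelowDiag : Domino → Set
StrictlyBelowDiag d = ∀ r c → (r , c) ∈ cells d → c < r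

WeaklyAboveDiag : Domino → Set
WeaklyAboveDiag d = ∃[ r ] ∃[ c ] ((r , c) ∈ cells d × r ≤ c)

OnDiag : Domino → Set
OnDiag d = ∃[ r ] ((r , r) ∈ cells d)

LeftAdjacent : Domino → Domino → Set
LeftAdjacent e d = ∃[ r ] ∃[ c ] ((r , c) ∈ cells e × (r , suc c) ∈ cells d)

IsShiftedTiling : List Domino → Set
IsShiftedTiling T =
  ∀ d → d ∈ T → vert d ≡ true → OnDiag d →
    ¬ (∀ e → e ∈ T → LeftAdjacent e d → StrictlyBelowDiag e)

StrictlyLower : Domino → Domino → Set
StrictlyLower e d = botRow d < topRow e

WeaklyBelow : Domino → Domino → Set
WeaklyBelow d e = topRow e ≤ botRow d

SameRowLeftOf : Domino → Domino → Set
SameRowLeftOf d e = ∃[ r ] ∃[ c ] ∃[ c' ] ((r , c) ∈ cells d × (r , c') ∈ cells e × c < c')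

SameColAbove : Domino → Domino → Set
SameColAbove d e = ∃[ c ] ∃[ r ] ∃[ r' ] ((r , c) ∈ cells d × (r' , c) ∈ cells e × r < r')

InRange : ℕ → ℕ → Set
InRange n i = 1 ≤ i × i ≤ n

record SShDT (λ' : List ℕ) : Set where
  field
    tiling    : List Domino
    isTiling  : IsTiling λ' tiling
    shifted   : IsShiftedTiling tiling
    n         : ℕ                 -- number of dominoes weakly above the diagonal
    domAt     : ℕ → Domino        -- i ↦ dom_i  (meaningful for i ∈ [n])
    domIn     : ∀ i → InRange n i → domAt i ∈ tiling × WeaklyAboveDiag (domAt i)
    domInj    : ∀ i j → InRange n i → InRange n j → domAt i ≡ domAt j → i ≡ j
    domSurj   : ∀ d → d ∈ tiling → WeaklyAboveDiag d → ∃[ i ] (InRange n i × domAt i ≡ d)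
    rowIncr   : ∀ i j → InRange n i → InRange n j → i ≢ j →
                SameRowLeftOf (domAt i) (domAt j) → i < j
    colIncr   : ∀ i j → InRange n i → InRange n j → i ≢ j →
                SameColAbove (domAt i) (domAt j) → i < j
open SShDT public

DescentQ : ∀ {λ'} → SShDT λ' → ℕ → Set
DescentQ Q i =
  i < n Q ×
  ((i ≡ 0 × vert (domAt Q 1) ≡ true) ⊎
   (1 ≤ i × StrictlyLower (domAt Q (suc i)) (domAt Q i)))

-- marked standard shifted domino tableaux: primed i = true means i' is the entry
record MSShDT (λ' : List ℕ) : Set where
  field
    demark : SShDT λ'
    primed : ℕ → Bool
open MSShDT public

nDom : ∀ {λ'} → MSShDT λ' → ℕ
nDom S = n (demark S)

domS : ∀ {λ'} → MSShDT λ' → ℕ → Domino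
domS S = domAt (demark S)

DescentS : ∀ {λ'} → MSShDT λ' → ℕ → Set
DescentS S i =
  i < nDom S ×
  ((i ≡ 0 × (primed S 1 ≡ true ⊎ vert (domS S 1) ≡ true)) ⊎
   (1 ≤ i × primed S i ≡ false × DescentQ (demark S) i) ⊎
   (1 ≤ i × primed S (suc i) ≡ true × ¬ DescentQ (demark S) i))

module Submission where

open import Defs
open import Data.Bool using (Bool; true; false)
open import Data.Nat using (ℕ; suc; _≤_; _<_; _∸_; _≤′_; ≤′-refl; ≤′-step; z≤n; s≤s; s≤s⁻¹; _<?_)
open import Data.Nat.Properties
open import Data.Product using (_×_; _,_; proj₁; proj₂; ∃-syntax)
open import Data.Product.Properties using (≡-dec)
open import Data.Sum using (_⊎_; inj₁; inj₂)
open import Data.Empty using (⊥; ⊥-elim)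
open import Data.List using (List; []; _∷_; length)
open import Data.List.Relation.Unary.Any using (here; there)
open import Data.List.Membership.Propositional using (_∈_)
open import Data.List.Membership.Propositional.Properties using (∈-filter⁺; ∈-filter⁻)
open import Data.List.Membership.DecPropositional (≡-dec _≟_ _≟_) using (_∈?_)
open import Relation.Binary.PropositionalEquality using (_≡_; refl; sym; subst)
open import Relation.Nullary using (¬_; yes; no)
open import Relation.Binary.Definitions using (tri<; tri≈; tri>)

-- If no descent lies in [i, j-1], then scanning k = i, …, j-1: an unprimed
-- entry is followed by an unprimed one whose domino starts weakly higher,
-- and a primed entry followed by a primed one has its successor strictly
-- lower.  The only geometric input is that dom_{k+1} cannot start in the
-- bottom row of a vertical dom_k: left of it contradicts row increase, on
-- it the two overlap, and right of it the cell above dom_{k+1} would carry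
-- an entry strictly between k and k+1.

part-antitone : ∀ {λ'} → Decreasing λ' → ∀ r → part λ' (suc r) ≤ part λ' r
part-antitone {[]}         _        r       = z≤n
part-antitone {x ∷ []}     _        r       = z≤n
part-antitone {x ∷ y ∷ xs} (y≤x , _) 0       = y≤x
part-antitone {x ∷ y ∷ xs} (_ , ds) (suc r) = part-antitone ds r

InShape-up : ∀ {λ' r c} → Decreasing λ' → InShape λ' (suc r , c) → InShape λ' (r , c)
InShape-up {r = r} decr inS = <-≤-trans inS (part-antitone decr r)

topLeft∈cells : ∀ d → (row d , col d) ∈ cells d
topLeft∈cells (dom r c true)  = here refl
topLeft∈cells (dom r c false) = here refl

topRow≤botRow : ∀ d → topRow d ≤ botRow d
topRow≤botRow (dom r c true)  = n≤1+n r
topRow≤botRow (dom r c false) = ≤-refl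

topRow≤cellRow : ∀ d {r c} → (r , c) ∈ cells d → topRow d ≤ r
topRow≤cellRow (dom r c true)  (here refl)         = ≤-refl
topRow≤cellRow (dom r c true)  (there (here refl)) = n≤1+n r
topRow≤cellRow (dom r c false) (here refl)         = ≤-refl
topRow≤cellRow (dom r c false) (there (here refl)) = ≤-refl

vertical-cell-col : ∀ {r c r' c'} → (r' , c') ∈ cells (dom r c true) → c' ≡ c
vertical-cell-col (here refl)         = refl
vertical-cell-col (there (here refl)) = refl

vertical-weaklyAbove⇒row≤col : ∀ {r c} → WeaklyAboveDiag (dom r c true) → r ≤ c
vertical-weaklyAbove⇒row≤col (_ , _ , here refl , r≤c)          = r≤c
vertical-weaklyAbove⇒row≤col (_ , _ , there (here refl) , 1+r≤c) = <⇒≤ 1+r≤c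

length≡1⇒nonEmpty : ∀ {A : Set} {xs : List A} → length xs ≡ 1 → ∃[ a ] (a ∈ xs)
length≡1⇒nonEmpty {xs = a ∷ _} _ = a , here refl

length≡1⇒∈-unique : ∀ {A : Set} {xs : List A} {a b : A} → length xs ≡ 1 → a ∈ xs → b ∈ xs → a ≡ b
length≡1⇒∈-unique {xs = _ ∷ []}    _  (here refl) (here refl) = refl
length≡1⇒∈-unique {xs = _ ∷ []}    _  (there ())  _
length≡1⇒∈-unique {xs = _ ∷ []}    _  (here _)    (there ())
length≡1⇒∈-unique {xs = _ ∷ _ ∷ _} ()

module _ {λ' : List ℕ} {T : List Domino} (tiling : IsTiling λ' T) where

  tiling-cover : ∀ {x} → InShape λ' x → ∃[ d ] (d ∈ T × x ∈ cells d)
  tiling-cover {x} inS with length≡1⇒nonEmpty (proj₂ tiling x inS)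
  ... | d , d∈ = d , ∈-filter⁻ (λ d → x ∈? cells d) d∈

  tiling-inShape : ∀ {d x} → d ∈ T → x ∈ cells d → InShape λ' x
  tiling-inShape d∈T x∈d = proj₁ tiling _ d∈T _ x∈d

  tiling-disjoint : ∀ {d e x} → d ∈ T → e ∈ T → x ∈ cells d → x ∈ cells e → d ≡ e
  tiling-disjoint {x = x} d∈T e∈T x∈d x∈e =
    length≡1⇒∈-unique (proj₂ tiling x (tiling-inShape d∈T x∈d))
      (∈-filter⁺ (λ d → x ∈? cells d) d∈T x∈d) (∈-filter⁺ (λ d → x ∈? cells d) e∈T x∈e)

module _ {λ' : List ℕ} (Q : SShDT λ') where

  private
    d : ℕ → Domino
    d = domAt Q
    N : ℕ
    N = n Q

  covering-entry : ∀ {r c} → InShape λ' (r , c) → r ≤ c → ∃[ m ] (InRange N m × (r , c) ∈ cells (d m))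
  covering-entry inS r≤c with tiling-cover {λ'} (isTiling Q) inS
  ... | e , e∈T , x∈e with domSurj Q e e∈T (_ , _ , x∈e , r≤c)
  ...   | m , mR , refl = m , mR , x∈e

  module _ (decr : Decreasing λ') {k r c : ℕ} (1≤k : 1 ≤ k) (k<N : k < N)
           (dk≡ : d k ≡ dom r c true) (top≡ : topRow (d (suc k)) ≡ suc r) where

    private
      kR : InRange N k
      kR = 1≤k , <⇒≤ k<N
      k+1R : InRange N (suc k)
      k+1R = s≤s z≤n , k<N
      b : Domino
      b = d (suc k)
      b-topLeft : (suc r , col b) ∈ cells b
      b-topLeft = subst (λ r' → (r' , col b) ∈ cells b) top≡ (topLeft∈cells b)
      lower∈dk : (suc r , c) ∈ cells (d k)
      lower∈dk = subst (λ e → (suc r , c) ∈ cells e) (sym dk≡) (there (here refl))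
      r≤c : r ≤ c
      r≤c = vertical-weaklyAbove⇒row≤col (subst WeaklyAboveDiag dk≡ (proj₂ (domIn Q k kR)))
      above-b : InShape λ' (r , col b)
      above-b = InShape-up decr (tiling-inShape {λ'} (isTiling Q) (proj₁ (domIn Q (suc k) k+1R)) b-topLeft)

    ¬next-row-after-vertical : ⊥
    ¬next-row-after-vertical with <-cmp (col b) c
    ... | tri< cb<c _ _ = <⇒≱ (rowIncr Q (suc k) k k+1R kR 1+n≢n
            (suc r , col b , c , b-topLeft , lower∈dk , cb<c)) (n≤1+n k)
    ... | tri≈ _ refl _ = 1+n≢n (sym (domInj Q k (suc k) kR k+1R
            (tiling-disjoint {λ'} (isTiling Q) (proj₁ (domIn Q k kR)) (proj₁ (domIn Q (suc k) k+1R))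
              lower∈dk b-topLeft)))
    ... | tri> _ _ c<cb with covering-entry above-b (≤-trans r≤c (<⇒≤ c<cb))
    ...   | m , mR , y∈dm = <⇒≱ k<m (s≤s⁻¹ m<k+1)
      where
      k<m : k < m
      k<m = rowIncr Q k m kR mR
              (λ { refl → <-irrefl (sym (vertical-cell-col (subst (λ e → (r , col b) ∈ cells e) dk≡ y∈dm))) c<cb })
              (r , c , col b , subst (λ e → (r , c) ∈ cells e) (sym dk≡) (here refl) , y∈dm , c<cb)
      m<k+1 : m < suc k
      m<k+1 = colIncr Q m (suc k) mR k+1R
                (λ { refl → 1+n≰n (subst (_≤ r) top≡ (topRow≤cellRow b y∈dm)) })
                (col b , r , suc r , y∈dm , b-topLeft , n<1+n r)

  notLower⇒topRow-antitone : Decreasing λ' → ∀ {k} → 1 ≤ k → k < N →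
    ¬ StrictlyLower (d (suc k)) (d k) → topRow (d (suc k)) ≤ topRow (d k)
  notLower⇒topRow-antitone decr {k} 1≤k k<N notLower with d k in dk≡
  ... | dom r c false = ≮⇒≥ notLower
  ... | dom r c true with m≤n⇒m<n∨m≡n (≮⇒≥ notLower)
  ...   | inj₁ above = s≤s⁻¹ above
  ...   | inj₂ top≡  = ⊥-elim (¬next-row-after-vertical decr 1≤k k<N dk≡ top≡)

DescentIn : ∀ {λ'} → MSShDT λ' → ℕ → ℕ → Set
DescentIn S i k = ∃[ m ] (i ≤ m × m ≤ k × DescentS S m)

module _ {λ' : List ℕ} (S : MSShDT λ') where

  private
    p : ℕ → Bool
    p = primed S
    d : ℕ → Domino
    d = domS S

  descentIn-last : ∀ {i k} → 1 ≤ i → i ≤′ k → (1 ≤ k → DescentS S k) → DescentIn S i k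
  descentIn-last {i} {k} 1≤i i≤′k D = k , i≤k , ≤-refl , D (≤-trans 1≤i i≤k)
    where
    i≤k : i ≤ k
    i≤k = ≤′⇒≤ i≤′k

  descentIn-step : ∀ {i k} → DescentIn S i k → DescentIn S i (suc k)
  descentIn-step (m , i≤m , m≤k , D) = m , i≤m , m≤n⇒m≤1+n m≤k , D

  unprimed-lower⇒descent : ∀ {k} → 1 ≤ k → k < nDom S → p k ≡ false →
    StrictlyLower (d (suc k)) (d k) → DescentS S k
  unprimed-lower⇒descent 1≤k k<n pk lower = k<n , inj₂ (inj₁ (1≤k , pk , k<n , inj₂ (1≤k , lower)))

  primed-notLower⇒descent : ∀ {k} → 1 ≤ k → k < nDom S → p (suc k) ≡ true →
    ¬ StrictlyLower (d (suc k)) (d k) → DescentS S k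
  primed-notLower⇒descent 1≤k k<n pk+1 notLower = k<n , inj₂ (inj₂ (1≤k , pk+1 , notDescentQ))
    where
    notDescentQ : ¬ DescentQ (demark S) _
    notDescentQ (_ , inj₁ (refl , _)) = <-irrefl refl 1≤k
    notDescentQ (_ , inj₂ (_ , lower)) = notLower lower

  unprimed-primed⇒descent : ∀ {k} → 1 ≤ k → k < nDom S → p k ≡ false → p (suc k) ≡ true → DescentS S k
  unprimed-primed⇒descent {k} 1≤k k<n pk pk+1 with botRow (d k) <? topRow (d (suc k))
  ... | yes lower   = unprimed-lower⇒descent 1≤k k<n pk lower
  ... | no notLower = primed-notLower⇒descent 1≤k k<n pk+1 notLower

  unprimed-primed⇒descentIn : ∀ {i k} → 1 ≤ i → i ≤′ k → k < nDom S → p i ≡ false → p (suc k) ≡ true →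
    DescentIn S i k
  unprimed-primed⇒descentIn 1≤i ≤′-refl i<n pi pi+1 =
    descentIn-last 1≤i ≤′-refl λ _ → unprimed-primed⇒descent 1≤i i<n pi pi+1
  unprimed-primed⇒descentIn {k = suc k} 1≤i (≤′-step i≤′k) k+1<n pi pk+2 with p (suc k) in pk+1
  ... | false = descentIn-last 1≤i (≤′-step i≤′k) λ 1≤k+1 → unprimed-primed⇒descent 1≤k+1 k+1<n pk+1 pk+2
  ... | true  = descentIn-step (unprimed-primed⇒descentIn 1≤i i≤′k (<⇒≤ k+1<n) pi pk+1)

  primed-weaklyBelow⇒descentIn : ∀ {i k} → 1 ≤ i → i ≤′ k → k < nDom S → p i ≡ true → p (suc k) ≡ true →
    topRow (d (suc k)) ≤ botRow (d i) → DescentIn S i k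
  primed-weaklyBelow⇒descentIn 1≤i i≤′k k<n pi pk+1 below with botRow (d _) <? topRow (d (suc _))
  ... | no notLower =
    descentIn-last 1≤i i≤′k λ 1≤k → primed-notLower⇒descent 1≤k k<n pk+1 notLower
  primed-weaklyBelow⇒descentIn 1≤i ≤′-refl i<n pi pi+1 below | yes lower = ⊥-elim (<⇒≱ lower below)
  primed-weaklyBelow⇒descentIn {k = suc k} 1≤i (≤′-step i≤′k) k+1<n pi pk+2 below | yes lower with p (suc k) in pk+1
  ... | false = descentIn-last 1≤i (≤′-step i≤′k) λ 1≤k+1 → unprimed-primed⇒descent 1≤k+1 k+1<n pk+1 pk+2
  ... | true  = descentIn-step (primed-weaklyBelow⇒descentIn 1≤i i≤′k (<⇒≤ k+1<n) pi pk+1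
                  (≤-trans (topRow≤botRow (d (suc k))) (<⇒≤ (<-≤-trans lower below))))

  unprimed-higher⇒descentIn : Decreasing λ' → ∀ {i k} → 1 ≤ i → i ≤′ k → k < nDom S → p i ≡ false →
    p (suc k) ≡ false → topRow (d i) < topRow (d (suc k)) → DescentIn S i k
  unprimed-higher⇒descentIn decr {i} 1≤i ≤′-refl i<n pi pi+1 higher with botRow (d i) <? topRow (d (suc i))
  ... | yes lower   = descentIn-last 1≤i ≤′-refl λ _ → unprimed-lower⇒descent 1≤i i<n pi lower
  ... | no notLower = ⊥-elim (<⇒≱ higher (notLower⇒topRow-antitone (demark S) decr 1≤i i<n notLower))
  unprimed-higher⇒descentIn decr {k = suc k} 1≤i (≤′-step i≤′k) k+1<n pi pk+2 higher with p (suc k) in pk+1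
  ... | true  = descentIn-step (unprimed-primed⇒descentIn 1≤i i≤′k (<⇒≤ k+1<n) pi pk+1)
  ... | false with botRow (d (suc k)) <? topRow (d (suc (suc k)))
  ...   | yes lower   = descentIn-last 1≤i (≤′-step i≤′k) λ 1≤k+1 → unprimed-lower⇒descent 1≤k+1 k+1<n pk+1 lower
  ...   | no notLower = descentIn-step (unprimed-higher⇒descentIn decr 1≤i i≤′k (<⇒≤ k+1<n) pi pk+1
                          (<-≤-trans higher (notLower⇒topRow-antitone (demark S) decr (s≤s z≤n) k+1<n notLower)))

lemma4p5 : ∀ (λ' : List ℕ) → IsPartition λ' → ShiftedCondition λ' →
    (S : MSShDT λ') → (i j : ℕ) → 1 ≤ i → i < j → j ≤ nDom S →
    ((primed S i ≡ false × primed S j ≡ true) ⊎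
     (primed S i ≡ false × primed S j ≡ false × StrictlyLower (domS S j) (domS S i)) ⊎
     (primed S i ≡ true × primed S j ≡ true × WeaklyBelow (domS S i) (domS S j))) →
    ∃[ k ] (i ≤ k × k ≤ j ∸ 1 × DescentS S k)
lemma4p5 _ _ _ S i (suc k) 1≤i (s≤s i≤k) k<n (inj₁ (pi , pk+1)) =
  unprimed-primed⇒descentIn S 1≤i (≤⇒≤′ i≤k) k<n pi pk+1
lemma4p5 _ (decr , _) _ S i (suc k) 1≤i (s≤s i≤k) k<n (inj₂ (inj₁ (pi , pk+1 , lower))) =
  unprimed-higher⇒descentIn S decr 1≤i (≤⇒≤′ i≤k) k<n pi pk+1 (≤-<-trans (topRow≤botRow (domS S i)) lower)
lemma4p5 _ _ _ S i (suc k) 1≤i (s≤s i≤k) k<n (inj₂ (inj₂ (pi , pk+1 , below))) =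
  primed-weaklyBelow⇒descentIn S 1≤i (≤⇒≤′ i≤k) k<n pi pk+1 below
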